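{- Let $p$ be a prime, $m$ and $d$ positive integers, and let $g:\mathbb Z_p\to\mathbb Z_p$ be a juggling function of type $m$. Then the function $f:\mathbb Z_p\to\mathbb Z_p^d$ given by $$f(x)=(x,g(x),g(g(x)),\ldots,g^{\circ(d-1)}(x)),$$ where $g^{\circ k}$ denotes the $k$-fold composition of $g$, is a decoding function of type $(d,m)$.
   Context: $\mathbb Z_p$ denotes the $p$-adic integers. A juggling function of type $m$ is a function $g:\mathbb Z_p\to\mathbb Z_p$ such that for every $y\in\mathbb Z_p$ and every coset $D$ of $p^m\mathbb Z_p$ in $\mathbb Z_p$ we have $g^{ -1}(y)\cap D\neq\emptyset$. A decoding function of type $(d,m)$ is a function $f:\mathbb Z_p\to\mathbb Z_p^d$ such that for every $y\in\mathbb Z_p^d$ there is an $x\in\mathbb Z_p$ with $y-f(x)\in p^m\mathbb Z_p^d$. -}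

module Defs where

open import Data.Nat using (ℕ; zero; suc; _+_; _*_; _^_)
open import Data.Fin using (Fin; toℕ)
open import Data.Product using (∃; _×_)
open import Relation.Binary.PropositionalEquality using (_≡_)

-- p-adic integers represented by their digit expansions:
-- x = Σ_{n ≥ 0} (x n) · p^n with digits x n ∈ {0,…,p-1}.
ℤₚ : ℕ → Set
ℤₚ p = ℕ → Fin p

_≈_ : ∀ {p} → ℤₚ p → ℤₚ p → Set
x ≈ y = ∀ n → x n ≡ y n

residue : ∀ {p} → ℕ → ℤₚ p → ℕ
residue {p} zero    x = 0
residue {p} (suc m) x = residue m x + toℕ (x m) * p ^ m

-- x - y ∈ p^m ℤₚ  (x and y have the same image in ℤ/p^mℤ)
_≡_[mod-p^_] : ∀ {p} → ℤₚ p → ℤₚ p → ℕ → Set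
x ≡ y [mod-p^ m ] = residue m x ≡ residue m y

-- Membership in the coset c + p^m ℤₚ (every coset of p^m ℤₚ has this form).
_∈Coset[_,_] : ∀ {p} → ℤₚ p → ℤₚ p → ℕ → Set
x ∈Coset[ c , m ] = x ≡ c [mod-p^ m ]

Respects≈ : ∀ {p} → (ℤₚ p → ℤₚ p) → Set
Respects≈ g = ∀ {x y} → x ≈ y → g x ≈ g y

IsJuggling : ∀ {p} → ℕ → (ℤₚ p → ℤₚ p) → Set
IsJuggling {p} m g = (y c : ℤₚ p) → ∃ λ x → x ∈Coset[ c , m ] × g x ≈ y

IsDecoding : ∀ {p} → (d m : ℕ) → (ℤₚ p → (Fin d → ℤₚ p)) → Set
IsDecoding {p} d m f = (y : Fin d → ℤₚ p) → ∃ λ x → ∀ i → y i ≡ f x i [mod-p^ m ]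

iter : ∀ {A : Set} → (A → A) → ℕ → A → A
iter g zero    x = x
iter g (suc k) x = g (iter g k x)

orbitMap : ∀ {p} (d : ℕ) → (ℤₚ p → ℤₚ p) → ℤₚ p → (Fin d → ℤₚ p)
orbitMap d g x i = iter g (toℕ i) x

{-# OPTIONS --safe #-}
-- Decode the tail (y₁, …, y_d) by some x′; juggling gives an
-- x congruent to y₀ modulo p^m with g x = x′, and the orbit of x is x followed
-- by the orbit of x′.
module Submission where

open import Defs
open import Data.Nat using (ℕ; _≥_; zero; suc; s≤s; _+_; _*_; _^_)
open import Data.Nat.Primality using (Prime)
open import Data.Fin using (toℕ)
import Data.Fin as Fin
open import Data.Product using (_,_)
open import Relation.Binary.PropositionalEquality
open ≡-Reasoning

iter-suc : ∀ {A : Set} (g : A → A) i x → iter g (suc i) x ≡ iter g i (g x)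
iter-suc g zero    x = refl
iter-suc g (suc i) x = cong g (iter-suc g i x)

iter-respects≈ : ∀ {p} {g : ℤₚ p → ℤₚ p} → Respects≈ g →
  ∀ i {x y : ℤₚ p} → x ≈ y → iter g i x ≈ iter g i y
iter-respects≈ g-resp zero    x≈y = x≈y
iter-respects≈ g-resp (suc i) x≈y = g-resp (iter-respects≈ g-resp i x≈y)

residue-cong : ∀ {p} m {x y : ℤₚ p} → x ≈ y → x ≡ y [mod-p^ m ]
residue-cong zero    x≈y = refl
residue-cong {p} (suc m) x≈y =
  cong₂ (λ r digit → r + toℕ digit * p ^ m) (residue-cong m x≈y) (x≈y m)

orbitMap-one-isDecoding : ∀ {p} m (g : ℤₚ p → ℤₚ p) → IsDecoding 1 m (orbitMap 1 g)
orbitMap-one-isDecoding m g y = y Fin.zero , λ { Fin.zero → refl }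

orbitMap-suc-isDecoding : ∀ {p} m d {g : ℤₚ p → ℤₚ p} → Respects≈ g → IsJuggling m g →
  IsDecoding d m (orbitMap d g) → IsDecoding (suc d) m (orbitMap (suc d) g)
orbitMap-suc-isDecoding m d {g} g-resp g-juggling decode y
  with decode (λ i → y (Fin.suc i))
... | x′ , y-tail≡orbit-x′ with g-juggling x′ (y Fin.zero)
... | x , x≡y₀ , gx≈x′ = x , y≡orbit-x
  where
  y≡orbit-x : ∀ i → y i ≡ orbitMap (suc d) g x i [mod-p^ m ]
  y≡orbit-x Fin.zero    = sym x≡y₀
  y≡orbit-x (Fin.suc i) = begin
    residue m (y (Fin.suc i))              ≡⟨ y-tail≡orbit-x′ i ⟩
    residue m (iter g (toℕ i) x′)          ≡⟨ residue-cong m (iter-respects≈ g-resp (toℕ i) gx≈x′) ⟨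
    residue m (iter g (toℕ i) (g x))       ≡⟨ cong (residue m) (iter-suc g (toℕ i) x) ⟨
    residue m (iter g (suc (toℕ i)) x)     ∎

orbitMap-isDecoding : ∀ {p} m d {g : ℤₚ p → ℤₚ p} → Respects≈ g → IsJuggling m g →
  IsDecoding (suc d) m (orbitMap (suc d) g)
orbitMap-isDecoding m zero    {g} g-resp g-juggling = orbitMap-one-isDecoding m g
orbitMap-isDecoding m (suc d)     g-resp g-juggling =
  orbitMap-suc-isDecoding m (suc d) g-resp g-juggling
    (orbitMap-isDecoding m d g-resp g-juggling)

lemma3p18 : (p m d : ℕ) → Prime p → m ≥ 1 → d ≥ 1 →
    (g : ℤₚ p → ℤₚ p) → Respects≈ g → IsJuggling m g →
    IsDecoding d m (orbitMap d g)
lemma3p18 p m (suc d) _ _ (s≤s _) g = orbitMap-isDecoding m d
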